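{- Let $G$ be a graph containing no subgraph isomorphic to $C_6$, let $x\in V(G)$, and let $A$ be a bipartite connected component of $G[N_2(x)]$ with bipartition classes $V_1$ and $V_2$ such that $\min(|V_1|,|V_2|)\ge 2$. Then $|N(x)\cap N(V(A))|=1$.
   Context: Graphs are finite, simple, undirected. For a nonempty set $S$ of vertices, $N(S)$ is the set of vertices at distance exactly $1$ from $S$; $N(x)=N(\{x\})$; $N_2(x)$ is the set of vertices at distance exactly $2$ from $x$. "No subgraph isomorphic to $C_6$" refers to not necessarily induced subgraphs. -}

module Defs where

open import Data.Nat using (ℕ; zero; suc)
open import Data.Bool using (Bool; true; false; _∧_; _∨_; not; T)
open import Data.Fin using (Fin; zero; suc; _≟_)
open import Data.Fin.Subset using (Subset; _∈_; _∉_; _⊆_; _∩_; _∪_; ⁅_⁆; Nonempty; ∣_∣)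
open import Data.Vec using (lookup; tabulate)
open import Data.Product using (Σ; _×_; _,_)
open import Function.Definitions using (Injective)
open import Relation.Binary.PropositionalEquality using (_≡_)
open import Relation.Nullary.Decidable using (⌊_⌋)

record Graph (n : ℕ) : Set where
  field
    adj    : Fin n → Fin n → Bool
    sym    : ∀ u v → adj u v ≡ adj v u
    irrefl : ∀ v → adj v v ≡ false
open Graph public

Adj : ∀ {n} → Graph n → Fin n → Fin n → Set
Adj G u v = T (adj G u v)

anyFin : ∀ {n} → (Fin n → Bool) → Bool
anyFin {zero}  f = false
anyFin {suc n} f = f zero ∨ anyFin (λ i → f (suc i))

N : ∀ {n} → Graph n → Subset n → Subset n
N G S = tabulate λ v → not (lookup S v) ∧ anyFin (λ u → lookup S u ∧ adj G u v)

Nv : ∀ {n} → Graph n → Fin n → Subset n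
Nv G x = N G ⁅ x ⁆

N₂ : ∀ {n} → Graph n → Fin n → Subset n
N₂ G x = tabulate λ v →
  not ⌊ v ≟ x ⌋ ∧ not (adj G x v) ∧ anyFin (λ u → adj G x u ∧ adj G u v)

-- G contains a (not necessarily induced) subgraph isomorphic to C₆:
-- six distinct vertices v₀,…,v₅ with vᵢ adjacent to vᵢ₊₁ (indices mod 6).
HasC6 : ∀ {n} → Graph n → Set
HasC6 {n} G = Σ (Fin 6 → Fin n) λ v → Injective _≡_ _≡_ v ×
  (Adj G (v (# 0)) (v (# 1)) × Adj G (v (# 1)) (v (# 2)) × Adj G (v (# 2)) (v (# 3)) ×
   Adj G (v (# 3)) (v (# 4)) × Adj G (v (# 4)) (v (# 5)) × Adj G (v (# 5)) (v (# 0)))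
  where open import Data.Fin using (#_)

-- A walk from u to w all of whose vertices lie in P
-- (i.e. a walk in the induced subgraph G[P]).
data WalkIn {n} (G : Graph n) (P : Subset n) : Fin n → Fin n → Set where
  [_]  : ∀ {v} → v ∈ P → WalkIn G P v v
  _∷_  : ∀ {u v w} → (u ∈ P × Adj G u v) → WalkIn G P v w → WalkIn G P u w

-- C is (the vertex set of) a connected component of the induced subgraph G[P]:
-- nonempty, contained in P, connected in G[P], and closed under
-- adjacency inside P (maximality).
IsComponent : ∀ {n} → Graph n → Subset n → Subset n → Set
IsComponent G P C =
  Nonempty C × C ⊆ P ×
  (∀ {u v} → u ∈ C → v ∈ C → WalkIn G P u v) ×
  (∀ {u v} → u ∈ C → v ∈ P → Adj G u v → v ∈ C)

IsBipartition : ∀ {n} → Graph n → Subset n → Subset n → Subset n → Set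
IsBipartition {n} G C V₁ V₂ =
  V₁ ∪ V₂ ≡ C ×
  (∀ {v : Fin n} → v ∈ V₁ → v ∉ V₂) ×
  (∀ {u v} → u ∈ V₁ → v ∈ V₁ → ¬ Adj G u v) ×
  (∀ {u v} → u ∈ V₂ → v ∈ V₂ → ¬ Adj G u v)
  where open import Relation.Nullary using (¬_)

module Submission where

-- Call w a *seer* of a ∈ N₂(x) if x ~ w ~ a.  Every a ∈ N₂(x) has a seer.
--   (1) If u ~ c ~ v is a path in N₂(x) with u ≠ v, then all seers of u and
--       of v coincide: two different seers w, w' would give the 6-cycle
--       x w u c v w'.
--   (2) In a connected bipartite graph, a relation that holds between the
--       ends of every 2-path and is transitive is forced between any two
--       distinct vertices of the same class (walk induction).  Since each
--       class has a second vertex, every class of A has a single seer, and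
--       that seer is adjacent to the whole class.
--   (3) A connected bipartite graph whose classes have size ≥ 2 contains two
--       disjoint edges a₁b₁, a₂b₂.  If the two classes had different seers
--       y and z, then y a₁ b₁ z b₂ a₂ would be a 6-cycle.
-- Hence both classes share one seer, which is the unique vertex of N(x) ∩ N(A).

open import Defs hiding (sym)
open import Data.Nat as ℕ using (_≤_; s≤s)
open import Data.Nat.Properties using (≤-trans)
import Data.Bool as Bool
open import Data.Bool using (Bool; true; false; not; T)
open import Data.Bool.Properties using (T-∧; T-∨; T-≡; not-¬; ¬-not; not-involutive)
open import Data.Fin using (Fin; zero; suc; _≟_)
open import Data.Fin.Properties using (any?)
open import Data.Fin.Subset using (Subset; _∈_; _∉_; _∩_; _⊆_; ⁅_⁆; ∣_∣)
open import Data.Fin.Subset.Properties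
  using (_∈?_; x∈⁅x⁆; x∈⁅y⁆⇒x≡y; ∣⁅x⁆∣≡1; ⊆-antisym; p⊆q⇒∣p∣≤∣q∣; x∈p∩q⁺; x∈p∩q⁻; x∈p∪q⁺; x∈p∪q⁻)
open import Data.Vec using ([]; _∷_; lookup; tabulate)
open import Data.Vec.Properties using (lookup∘tabulate; []=⇒lookup; lookup⇒[]=)
open import Data.Vec.Relation.Unary.All using ([]; _∷_)
open import Data.Vec.Relation.Unary.AllPairs using ([]; _∷_)
open import Data.Vec.Relation.Unary.Unique.Propositional using (Unique)
open import Data.Vec.Relation.Unary.Unique.Propositional.Properties using (lookup-injective)
open import Data.Product using (_×_; _,_; proj₁; proj₂; ∃)
open import Data.Sum using (_⊎_; inj₁; inj₂)
open import Data.Empty using (⊥-elim)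
open import Function using (_∘_)
open import Function.Bundles using (module Equivalence)
open import Relation.Binary.PropositionalEquality
  using (_≡_; _≢_; refl; sym; trans; cong; subst; ≢-sym)
open import Relation.Nullary using (¬_; Dec; yes; no)
open import Relation.Nullary.Decidable using (⌊_⌋; toWitnessFalse; _×-dec_; ¬?)

open Equivalence using (to; from)

∈-tabulate⁻ : ∀ {n} (f : Fin n → Bool) {v} → v ∈ tabulate f → T (f v)
∈-tabulate⁻ f {v} v∈ = from T-≡ (trans (sym (lookup∘tabulate f v)) ([]=⇒lookup v∈))

∈-tabulate⁺ : ∀ {n} (f : Fin n → Bool) {v} → T (f v) → v ∈ tabulate f
∈-tabulate⁺ f {v} t = lookup⇒[]= v (tabulate f) (trans (lookup∘tabulate f v) (to T-≡ t))

∈⇒T : ∀ {n} {p : Subset n} {v} → v ∈ p → T (lookup p v)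
∈⇒T v∈ = from T-≡ ([]=⇒lookup v∈)

T⇒∈ : ∀ {n} (p : Subset n) {v} → T (lookup p v) → v ∈ p
T⇒∈ p {v} t = lookup⇒[]= v p (to T-≡ t)

∉⇒T-not : ∀ {n} (p : Subset n) {v} → v ∉ p → T (not (lookup p v))
∉⇒T-not p {v} v∉ with lookup p v in eq
... | true  = ⊥-elim (v∉ (lookup⇒[]= v p eq))
... | false = _

T-not⇒¬T : ∀ {b} → T (not b) → ¬ T b
T-not⇒¬T {false} _ ()

anyFin⁻ : ∀ {n} (f : Fin n → Bool) → T (anyFin f) → ∃ λ i → T (f i)
anyFin⁻ {ℕ.zero}  f ()
anyFin⁻ {ℕ.suc _} f t with to T-∨ t
... | inj₁ t₀ = zero , t₀
... | inj₂ tₛ = let (i , tᵢ) = anyFin⁻ (f ∘ suc) tₛ in suc i , tᵢ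

anyFin⁺ : ∀ {n} (f : Fin n → Bool) i → T (f i) → T (anyFin f)
anyFin⁺ f zero    t = from T-∨ (inj₁ t)
anyFin⁺ f (suc i) t = from T-∨ (inj₂ (anyFin⁺ (f ∘ suc) i t))

another-element : ∀ {n} (p : Subset n) (v : Fin n) → 2 ≤ ∣ p ∣ → ∃ λ u → u ∈ p × u ≢ v
another-element p v 2≤∣p∣ with any? (λ u → (u ∈? p) ×-dec ¬? (u ≟ v))
... | yes found = found
... | no none with ≤-trans 2≤∣p∣ (subst (∣ p ∣ ≤_) (∣⁅x⁆∣≡1 v) (p⊆q⇒∣p∣≤∣q∣ p⊆⁅v⁆))
  where
  p⊆⁅v⁆ : p ⊆ ⁅ v ⁆
  p⊆⁅v⁆ {u} u∈p with u ≟ v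
  ... | yes refl = x∈⁅x⁆ v
  ... | no  u≢v  = ⊥-elim (none (u , u∈p , u≢v))
... | s≤s ()

singleton-size : ∀ {n} {p : Subset n} {w} → w ∈ p → (∀ {u} → u ∈ p → u ≡ w) → ∣ p ∣ ≡ 1
singleton-size {p = p} {w} w∈p only-w = trans (cong ∣_∣ p≡⁅w⁆) (∣⁅x⁆∣≡1 w)
  where
  p≡⁅w⁆ : p ≡ ⁅ w ⁆
  p≡⁅w⁆ = ⊆-antisym (λ u∈p → subst (_∈ ⁅ w ⁆) (sym (only-w u∈p)) (x∈⁅x⁆ w))
                    (λ u∈⁅w⁆ → subst (_∈ p) (sym (x∈⁅y⁆⇒x≡y w u∈⁅w⁆)) w∈p)

module _ {n} (G : Graph n) where

  adj-sym : ∀ {u v} → Adj G u v → Adj G v u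
  adj-sym {u} {v} = subst T (Graph.sym G u v)

  adj⇒≢ : ∀ {u v} → Adj G u v → u ≢ v
  adj⇒≢ {u} uv refl = subst T (irrefl G u) uv

  c6 : ∀ {a b c d e f} → Unique (a ∷ b ∷ c ∷ d ∷ e ∷ f ∷ []) →
       Adj G a b → Adj G b c → Adj G c d → Adj G d e → Adj G e f → Adj G f a → HasC6 G
  c6 distinct ab bc cd de ef fa =
    lookup (_ ∷ _ ∷ _ ∷ _ ∷ _ ∷ _ ∷ []) , (λ {i} {j} → lookup-injective distinct i j) ,
    ab , bc , cd , de , ef , fa

  ∈N⁻ : ∀ {S v} → v ∈ N G S → v ∉ S × ∃ λ u → u ∈ S × Adj G u v
  ∈N⁻ {S} v∈ =
    let (v∉S , some) = to T-∧ (∈-tabulate⁻ _ v∈)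
        (u , t)      = anyFin⁻ _ some
        (u∈S , uv)   = to T-∧ t
    in T-not⇒¬T v∉S ∘ ∈⇒T , u , T⇒∈ S u∈S , uv

  ∈N⁺ : ∀ {S u v} → v ∉ S → u ∈ S → Adj G u v → v ∈ N G S
  ∈N⁺ {S} {u} v∉S u∈S uv =
    ∈-tabulate⁺ _ (from T-∧ (∉⇒T-not S v∉S , anyFin⁺ _ u (from T-∧ (∈⇒T u∈S , uv))))

not-not : ∀ {s t u : Bool} → t ≡ not s → u ≡ not t → u ≡ s
not-not {s} refl refl = not-involutive s

module BipartiteComponent {n} (G : Graph n) {P C V₁ V₂ : Subset n}
  (component : IsComponent G P C) (bipartition : IsBipartition G C V₁ V₂)
  (2≤∣V₁∣ : 2 ≤ ∣ V₁ ∣) (2≤∣V₂∣ : 2 ≤ ∣ V₂ ∣) where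

  C⊆P : C ⊆ P
  C⊆P = proj₁ (proj₂ component)

  connected : ∀ {u v} → u ∈ C → v ∈ C → WalkIn G P u v
  connected = proj₁ (proj₂ (proj₂ component))

  closed : ∀ {u v} → u ∈ C → v ∈ P → Adj G u v → v ∈ C
  closed = proj₂ (proj₂ (proj₂ component))

  walk-start : ∀ {u v} → WalkIn G P u v → u ∈ P
  walk-start [ u∈P ]           = u∈P
  walk-start ((u∈P , _) ∷ _) = u∈P

  side : Fin n → Bool
  side c = ⌊ c ∈? V₁ ⌋

  side-V₁ : ∀ {c} → c ∈ V₁ → side c ≡ true
  side-V₁ {c} c∈V₁ with c ∈? V₁
  ... | yes _    = refl
  ... | no c∉V₁ = ⊥-elim (c∉V₁ c∈V₁)

  side-V₂ : ∀ {c} → c ∈ V₂ → side c ≡ false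
  side-V₂ {c} c∈V₂ with c ∈? V₁
  ... | yes c∈V₁ = ⊥-elim (proj₁ (proj₂ bipartition) c∈V₁ c∈V₂)
  ... | no _     = refl

  in-V₂ : ∀ {c} → c ∈ C → c ∉ V₁ → c ∈ V₂
  in-V₂ {c} c∈C c∉V₁ with x∈p∪q⁻ V₁ V₂ (subst (c ∈_) (sym (proj₁ bipartition)) c∈C)
  ... | inj₁ c∈V₁ = ⊥-elim (c∉V₁ c∈V₁)
  ... | inj₂ c∈V₂ = c∈V₂

  in-C : ∀ {c} → c ∈ V₁ ⊎ c ∈ V₂ → c ∈ C
  in-C {c} c∈V = subst (c ∈_) (proj₁ bipartition) (x∈p∪q⁺ c∈V)

  side-adj : ∀ {u v} → u ∈ C → v ∈ C → Adj G u v → side v ≡ not (side u)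
  side-adj {u} {v} u∈C v∈C uv with u ∈? V₁ | v ∈? V₁
  ... | yes u∈V₁ | yes v∈V₁ = ⊥-elim (proj₁ (proj₂ (proj₂ bipartition)) u∈V₁ v∈V₁ uv)
  ... | yes _    | no _     = refl
  ... | no _     | yes _    = refl
  ... | no u∉V₁  | no v∉V₁  =
    ⊥-elim (proj₂ (proj₂ (proj₂ bipartition)) (in-V₂ u∈C u∉V₁) (in-V₂ v∈C v∉V₁) uv)

  different-sides : ∀ {s u v} → side u ≡ s → side v ≡ not s → u ≢ v
  different-sides su sv refl = not-¬ refl (trans (sym su) sv)

  partner : ∀ a → ∃ λ a' → a' ∈ C × side a' ≡ side a × a' ≢ a
  partner a with a ∈? V₁
  ... | yes _ =
    let (a' , a'∈V₁ , a'≢a) = another-element V₁ a 2≤∣V₁∣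
    in a' , in-C (inj₁ a'∈V₁) , side-V₁ a'∈V₁ , a'≢a
  ... | no _ =
    let (a' , a'∈V₂ , a'≢a) = another-element V₂ a 2≤∣V₂∣
    in a' , in-C (inj₂ a'∈V₂) , side-V₂ a'∈V₂ , a'≢a

  -- Every vertex of C has a neighbour in C: walk towards its partner.
  neighbour : ∀ {a} → a ∈ C → ∃ λ v → v ∈ C × Adj G a v
  neighbour {a} a∈C =
    let (a' , a'∈C , _ , a'≢a) = partner a in first-step (connected a∈C a'∈C) (≢-sym a'≢a)
    where
    first-step : ∀ {b} → WalkIn G P a b → a ≢ b → ∃ λ v → v ∈ C × Adj G a v
    first-step [ _ ]             a≢a = ⊥-elim (a≢a refl)
    first-step ((_ , av) ∷ rest) _   = _ , closed a∈C (walk-start rest) av , av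

  module _ (R : Fin n → Fin n → Set)
    (R-path : ∀ {u c v} → u ∈ C → c ∈ C → v ∈ C → Adj G u c → Adj G c v → u ≢ v → R u v)
    (R-trans : ∀ {u v w} → v ∈ C → R u v → R v w → R u w) where

    same-side-walk : ∀ {a b} → a ∈ C → WalkIn G P a b → side a ≡ side b → a ≢ b → R a b
    same-side-walk _   [ _ ]                 _     a≢a = ⊥-elim (a≢a refl)
    same-side-walk a∈C ((_ , ab) ∷ [ b∈P ]) sa≡sb _   =
      ⊥-elim (not-¬ (sym sa≡sb) (side-adj a∈C (closed a∈C b∈P ab) ab))
    same-side-walk {a} {b} a∈C (_∷_ {v = c} (_ , ac) (_∷_ {v = d} (c∈P , cd) rest)) sa≡sb a≢b =
      via-d (d ≟ b) (a ≟ d)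
      where
      c∈C : c ∈ C
      c∈C = closed a∈C c∈P ac
      d∈C : d ∈ C
      d∈C = closed c∈C (walk-start rest) cd
      sd≡sb : side d ≡ side b
      sd≡sb = trans (not-not (side-adj a∈C c∈C ac) (side-adj c∈C d∈C cd)) sa≡sb
      via-d : Dec (d ≡ b) → Dec (a ≡ d) → R a b
      via-d (yes d≡b) _         = subst (R a) d≡b (R-path a∈C c∈C d∈C ac cd (λ a≡d → a≢b (trans a≡d d≡b)))
      via-d (no d≢b)  (yes a≡d) = subst (λ t → R t b) (sym a≡d) (same-side-walk d∈C rest sd≡sb d≢b)
      via-d (no d≢b)  (no a≢d)  =
        R-trans d∈C (R-path a∈C c∈C d∈C ac cd a≢d) (same-side-walk d∈C rest sd≡sb d≢b)

    same-side : ∀ {a b} → a ∈ C → b ∈ C → side a ≡ side b → a ≢ b → R a b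
    same-side a∈C b∈C = same-side-walk a∈C (connected a∈C b∈C)

  record TwoDisjointEdges (s : Bool) : Set where
    constructor two-edges
    field
      a₁ b₁ a₂ b₂ : Fin n
      a₁∈C : a₁ ∈ C
      b₁∈C : b₁ ∈ C
      a₂∈C : a₂ ∈ C
      b₂∈C : b₂ ∈ C
      side-a₁ : side a₁ ≡ s
      side-a₂ : side a₂ ≡ s
      a₁≢a₂ : a₁ ≢ a₂
      b₁≢b₂ : b₁ ≢ b₂
      a₁b₁ : Adj G a₁ b₁
      a₂b₂ : Adj G a₂ b₂

  -- Because both classes have two vertices and C is connected, C is not a
  -- star, so it contains two disjoint edges; one of them can be taken at a.
  two-disjoint-edges : ∀ {a} → a ∈ C → TwoDisjointEdges (side a)
  two-disjoint-edges {a} a∈C with neighbour a∈C | partner a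
  ... | v , v∈C , av | u , u∈C , su , u≢a with neighbour u∈C
  ... | v' , v'∈C , uv' with v' ≟ v
  ... | no v'≢v = two-edges a v u v' a∈C v∈C u∈C v'∈C refl su (≢-sym u≢a) (≢-sym v'≢v) av uv'
  ... | yes refl with partner v
  ... | w , w∈C , sw , w≢v with neighbour w∈C
  ... | u' , u'∈C , wu' with u' ≟ a
  ... | no u'≢a =
    two-edges a v u' w a∈C v∈C u'∈C w∈C refl su' (≢-sym u'≢a) (≢-sym w≢v) av (adj-sym G wu')
    where
    su' : side u' ≡ side a
    su' = not-not (trans sw (side-adj a∈C v∈C av)) (side-adj w∈C u'∈C wu')
  ... | yes refl =
    two-edges a w u v a∈C w∈C u∈C v∈C refl su (≢-sym u≢a) w≢v (adj-sym G wu') uv'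

module Seers {n} (G : Graph n) (x : Fin n) where

  Sees : Fin n → Fin n → Set
  Sees w a = Adj G x w × Adj G w a

  ∈N₂⁻ : ∀ {v} → v ∈ N₂ G x → v ≢ x × ¬ Adj G x v × ∃ λ w → Sees w v
  ∈N₂⁻ {v} v∈N₂ =
    let (v≢x , rest)    = to T-∧ (∈-tabulate⁻ _ v∈N₂)
        (¬xv , common)  = to T-∧ rest
        (w , xw∧wv)     = anyFin⁻ _ common
    in toWitnessFalse {a? = v ≟ x} v≢x , T-not⇒¬T ¬xv , w , to T-∧ xw∧wv

  seer : ∀ {v} → v ∈ N₂ G x → ∃ λ w → Sees w v
  seer = proj₂ ∘ proj₂ ∘ ∈N₂⁻

  x≢N₂ : ∀ {v} → v ∈ N₂ G x → x ≢ v
  x≢N₂ = ≢-sym ∘ proj₁ ∘ ∈N₂⁻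

  N≢N₂ : ∀ {w v} → Adj G x w → v ∈ N₂ G x → w ≢ v
  N≢N₂ xw v∈N₂ refl = proj₁ (proj₂ (∈N₂⁻ v∈N₂)) xw

  attached⁻ : ∀ {A w} → w ∈ Nv G x ∩ N G A → ∃ λ a → a ∈ A × Sees w a
  attached⁻ {A} {w} w∈ =
    let (w∈Nx , w∈NA)          = x∈p∩q⁻ (Nv G x) (N G A) w∈
        (_ , u , u∈⁅x⁆ , uw) = ∈N⁻ G w∈Nx
        (_ , a , a∈A , aw)   = ∈N⁻ G w∈NA
    in a , a∈A , subst (λ u → Adj G u w) (x∈⁅y⁆⇒x≡y x u∈⁅x⁆) uw , adj-sym G aw

  attached⁺ : ∀ {A a w} → A ⊆ N₂ G x → a ∈ A → Sees w a → w ∈ Nv G x ∩ N G A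
  attached⁺ A⊆N₂ a∈A (xw , wa) =
    x∈p∩q⁺ ( ∈N⁺ G (λ w∈⁅x⁆ → adj⇒≢ G xw (sym (x∈⁅y⁆⇒x≡y x w∈⁅x⁆))) (x∈⁅x⁆ x) xw
           , ∈N⁺ G (λ w∈A → N≢N₂ xw (A⊆N₂ w∈A) refl) a∈A (adj-sym G wa))

module SharedSeers {n} (G : Graph n) (noC6 : ¬ HasC6 G) (x : Fin n) where
  open Seers G x

  SameSeer : Fin n → Fin n → Set
  SameSeer a b = ∀ {w w'} → Sees w a → Sees w' b → w ≡ w'

  -- SameSeer is transitive through vertices of N₂(x), which have a seer.
  sameSeer-trans : ∀ {a b c} → b ∈ N₂ G x → SameSeer a b → SameSeer b c → SameSeer a c
  sameSeer-trans b∈N₂ ab bc sa sc = let (_ , sb) = seer b∈N₂ in trans (ab sa sb) (bc sb sc)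

  -- Two seers w ≠ w' of the ends of a path u c v would close the cycle x w u c v w'.
  path⇒sameSeer : ∀ {u c v} → u ∈ N₂ G x → c ∈ N₂ G x → v ∈ N₂ G x →
                  Adj G u c → Adj G c v → u ≢ v → SameSeer u v
  path⇒sameSeer {u} {c} {v} u∈ c∈ v∈ uc cv u≢v {w} {w'} (xw , wu) (xw' , w'v) with w ≟ w'
  ... | yes w≡w' = w≡w'
  ... | no  w≢w' = ⊥-elim (noC6 (c6 G distinct xw wu uc cv (adj-sym G w'v) (adj-sym G xw')))
    where
    distinct : Unique (x ∷ w ∷ u ∷ c ∷ v ∷ w' ∷ [])
    distinct =
      (adj⇒≢ G xw ∷ x≢N₂ u∈ ∷ x≢N₂ c∈ ∷ x≢N₂ v∈ ∷ adj⇒≢ G xw' ∷ []) ∷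
      (N≢N₂ xw u∈ ∷ N≢N₂ xw c∈ ∷ N≢N₂ xw v∈ ∷ w≢w' ∷ []) ∷
      (adj⇒≢ G uc ∷ u≢v ∷ ≢-sym (N≢N₂ xw' u∈) ∷ []) ∷
      (adj⇒≢ G cv ∷ ≢-sym (N≢N₂ xw' c∈) ∷ []) ∷
      (≢-sym (N≢N₂ xw' v∈) ∷ []) ∷
      [] ∷ []

module Attachment {n} (G : Graph n) (noC6 : ¬ HasC6 G) (x : Fin n) {A V₁ V₂ : Subset n}
  (component : IsComponent G (N₂ G x) A) (bipartition : IsBipartition G A V₁ V₂)
  (2≤∣V₁∣ : 2 ≤ ∣ V₁ ∣) (2≤∣V₂∣ : 2 ≤ ∣ V₂ ∣) where
  open Seers G x
  open SharedSeers G noC6 x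
  open BipartiteComponent G component bipartition 2≤∣V₁∣ 2≤∣V₂∣

  distinct-same-side⇒sameSeer : ∀ {a b} → a ∈ A → b ∈ A → side a ≡ side b → a ≢ b → SameSeer a b
  distinct-same-side⇒sameSeer = same-side SameSeer
    (λ u∈A c∈A v∈A → path⇒sameSeer (C⊆P u∈A) (C⊆P c∈A) (C⊆P v∈A))
    (λ v∈A → sameSeer-trans (C⊆P v∈A))

  -- Every vertex of A has a unique seer: compare with its partner.
  single-seer : ∀ {a} → a ∈ A → SameSeer a a
  single-seer {a} a∈A sw sw' =
    let (a' , a'∈A , sa' , a'≢a) = partner a
        aa'                      = distinct-same-side⇒sameSeer a∈A a'∈A (sym sa') (≢-sym a'≢a)
        (_ , sa'')               = seer (C⊆P a'∈A)
    in trans (aa' sw sa'') (sym (aa' sw' sa''))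

  same-side⇒sameSeer : ∀ {a b} → a ∈ A → b ∈ A → side a ≡ side b → SameSeer a b
  same-side⇒sameSeer {a} {b} a∈A b∈A sa≡sb with a ≟ b
  ... | yes refl = single-seer a∈A
  ... | no a≢b   = distinct-same-side⇒sameSeer a∈A b∈A sa≡sb a≢b

  dominates : ∀ {y a c} → Sees y a → a ∈ A → c ∈ A → side c ≡ side a → Adj G y c
  dominates {c = c} sy a∈A c∈A sc≡sa =
    let (w , xw , wc) = seer (C⊆P c∈A)
    in subst (λ t → Adj G t c) (sym (same-side⇒sameSeer a∈A c∈A (sym sc≡sa) sy (xw , wc))) wc

  -- Distinct seers y, z of the two sides close the 6-cycle y a₁ b₁ z b₂ a₂.
  opposite-seers⇒C6 : ∀ {y z a b} → a ∈ A → b ∈ A → side b ≡ not (side a) →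
                      Sees y a → Sees z b → y ≢ z → HasC6 G
  opposite-seers⇒C6 {y} {z} {a} a∈A b∈A sb sy sz y≢z =
    c6 G distinct (Y a₁∈C side-a₁) a₁b₁ (adj-sym G (Z b₁∈C sb₁)) (Z b₂∈C sb₂) (adj-sym G a₂b₂)
       (adj-sym G (Y a₂∈C side-a₂))
    where
    open TwoDisjointEdges (two-disjoint-edges a∈A)
    Y : ∀ {c} → c ∈ A → side c ≡ side a → Adj G y c
    Y = dominates sy a∈A
    Z : ∀ {c} → c ∈ A → side c ≡ not (side a) → Adj G z c
    Z c∈A sc = dominates sz b∈A c∈A (trans sc (sym sb))
    sb₁ : side b₁ ≡ not (side a)
    sb₁ = trans (side-adj a₁∈C b₁∈C a₁b₁) (cong not side-a₁)
    sb₂ : side b₂ ≡ not (side a)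
    sb₂ = trans (side-adj a₂∈C b₂∈C a₂b₂) (cong not side-a₂)
    y≢ : ∀ {c} → c ∈ A → y ≢ c
    y≢ c∈A = N≢N₂ (proj₁ sy) (C⊆P c∈A)
    z≢ : ∀ {c} → c ∈ A → z ≢ c
    z≢ c∈A = N≢N₂ (proj₁ sz) (C⊆P c∈A)
    distinct : Unique (y ∷ a₁ ∷ b₁ ∷ z ∷ b₂ ∷ a₂ ∷ [])
    distinct =
      (y≢ a₁∈C ∷ y≢ b₁∈C ∷ y≢z ∷ y≢ b₂∈C ∷ y≢ a₂∈C ∷ []) ∷
      (different-sides side-a₁ sb₁ ∷ ≢-sym (z≢ a₁∈C) ∷ different-sides side-a₁ sb₂ ∷ a₁≢a₂ ∷ []) ∷
      (≢-sym (z≢ b₁∈C) ∷ b₁≢b₂ ∷ ≢-sym (different-sides side-a₂ sb₁) ∷ []) ∷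
      (z≢ b₂∈C ∷ z≢ a₂∈C ∷ []) ∷
      (≢-sym (different-sides side-a₂ sb₂) ∷ []) ∷
      [] ∷ []

  attached-unique : ∀ {w w'} → w ∈ Nv G x ∩ N G A → w' ∈ Nv G x ∩ N G A → w ≡ w'
  attached-unique {w} {w'} w∈ w'∈ with attached⁻ w∈ | attached⁻ w'∈
  ... | a , a∈A , sw | b , b∈A , sw' with side a Bool.≟ side b | w ≟ w'
  ... | yes sa≡sb | _         = same-side⇒sameSeer a∈A b∈A sa≡sb sw sw'
  ... | no _      | yes w≡w' = w≡w'
  ... | no sa≢sb  | no w≢w'  =
    ⊥-elim (noC6 (opposite-seers⇒C6 a∈A b∈A (¬-not (≢-sym sa≢sb)) sw sw' w≢w'))

  attached-exists : ∃ λ w → w ∈ Nv G x ∩ N G A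
  attached-exists =
    let (a , a∈A) = proj₁ component
        (w , sw)  = seer (C⊆P a∈A)
    in w , attached⁺ C⊆P a∈A sw

lemma5 : ∀ {n} (G : Graph n) → ¬ HasC6 G → (x : Fin n) →
    (A V₁ V₂ : Subset n) →
    IsComponent G (N₂ G x) A → IsBipartition G A V₁ V₂ →
    2 ≤ ∣ V₁ ∣ → 2 ≤ ∣ V₂ ∣ →
    ∣ Nv G x ∩ N G A ∣ ≡ 1
lemma5 G noC6 x A V₁ V₂ component bipartition 2≤∣V₁∣ 2≤∣V₂∣ =
  let (w , w∈) = attached-exists in singleton-size w∈ (λ u∈ → attached-unique u∈ w∈)
  where open Attachment G noC6 x component bipartition 2≤∣V₁∣ 2≤∣V₂∣
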